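{- Let $\mathbb G$ be a cyclic group (isomorphic to $\mathbb Z_n$ for some $n$ or to $\mathbb Z$) with generator denoted $1$, let $(\mathbf A,\mathbf A')$ be a promise template and $k\ge1$. The $\mathbb G$-affine $k$-consistency relaxation solves $\mathrm{PCSP}(\mathbf A,\mathbf A')$ if and only if $\mathrm{PCSP}(\mathbf A,\mathbf A')$ reduces to $\mathrm{CSP}(\mathbb G)$ by the $k$-consistency reduction, i.e., $\kappa_k^{\mathbf A,\mathbf G}$ is a reduction from $\mathrm{PCSP}(\mathbf A,\mathbf A')$ to $\mathrm{CSP}(\mathbf G)$.
   Context: Signatures and structures: a (multisorted relational) signature consists of types and relational symbols with arities (tuples of types); a structure has a set $A_t$ per type and relations $R^{\mathbf A}\subseteq A_{\mathrm{ar}_R(1)}\times\dots\times A_{\mathrm{ar}_R(k)}$; homomorphisms are type-wise maps preserving relations. The power $\mathbf B^D$ has domains $B_t^D$ and coordinatewise relations. Promise CSP: a promise template is a pair $(\mathbf A,\mathbf A')$ of structures of the same signature with $\mathbf A$ finite and $\mathbf A\to\mathbf A'$; $\mathrm{PCSP}(\mathbf A,\mathbf A')$: given finite $\mathbf X$, yes if $\mathbf X\to\mathbf A$, no if $\mathbf X\not\to\mathbf A'$; $\mathrm{CSP}(\mathbf B)=\mathrm{PCSP}(\mathbf B,\mathbf B)$. A map $\psi$ is a reduction from $\mathrm{PCSP}(\mathbf A,\mathbf A')$ to $\mathrm{PCSP}(\mathbf B,\mathbf B')$ if for all finite $\mathbf X$: $\mathbf X\to\mathbf A\Rightarrow\psi(\mathbf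 X)\to\mathbf B$ and $\psi(\mathbf X)\to\mathbf B'\Rightarrow\mathbf X\to\mathbf A'$. $\mathrm{CSP}(\mathbb G)$ for an Abelian group $\mathbb G$ is $\mathrm{CSP}(\mathbf G)$ where $\mathbf G$ is the single-sorted structure with domain $G$, the ternary relation $\{(x_1,x_2,y):x_1+x_2=y\}$, and a unary relation $\{b\}$ for each $b\in G$. $k$-consistency: for $\mathbf X$ and a set $K$ of its elements, a partial homomorphism $K\to\mathbf A$ is a type-preserving $f\colon K\to A$ with $(f(v_1),\dots,f(v_m))\in R^{\mathbf A}$ whenever $(v_1,\dots,v_m)\in R^{\mathbf X}$ with all $v_i\in K$. (1) For each set $K$ of at most $k$ elements let $\mathcal F_K$ be all partial homomorphisms $K\to\mathbf A$; (2) for $L\subset K$ remove from $\mathcal F_L$ the maps not extending to a member of $\mathcal F_K$ and from $\mathcal F_K$ the maps $g$ with $g|_L\notin\mathcal F_L$; (3) repeat (2) until stable. The $k$-consistency reduction $\kappa_k^{\mathbf A,\mathbf B}(\mathbf X)$ continues: (4) take a copy of $\mathbf B^{\mathcal F_K}$ (elements $(K;b)$) for each $K$; (5) identify $(K;b\circ\rho)$ with $(L;b)$ for all $L\subseteq K$, $b\colon\mathcal F_L\to B_t$, $\rho\colon\mathcal F_K\to\mathcal F_L$ restriction, and take the quotient. $\mathbb G$-affine $k$-consistency relaxation: given $\mathbf X$, compute $\mathcal F_K$ by steps (1)--(3) and form the system of equations over $\mathbb G$ in variables $x_{K,f}$ ($K$ of size at most $k$, $f\in\mathcal F_K$): $\sum_{f\in\mathcal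 F_K}x_{K,f}=1$ for each $K$, and $\sum_{f\in\mathcal F_K,f|_L=g}x_{K,f}=x_{L,g}$ for each $L\subset K$ and $g\in\mathcal F_L$. It solves $\mathrm{PCSP}(\mathbf A,\mathbf A')$ if for every finite $\mathbf X$: $\mathbf X\to\mathbf A$ implies the system has a solution in $\mathbb G$, and $\mathbf X\not\to\mathbf A'$ implies it has none. -}

module Defs where

open import Level using (0ℓ)
open import Data.Nat using (ℕ; zero; suc; _≤_)
open import Data.Integer using (ℤ; +_; -[1+_])
open import Data.Fin using (Fin)
import Data.Fin as Fin
open import Data.Fin.Subset using (Subset; _∈_; _∉_; _⊆_; _⊂_; ∣_∣)
open import Data.Vec using (Vec; lookup; zipWith)
open import Data.Maybe using (Maybe; just; nothing)
open import Data.Bool using (if_then_else_)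
open import Data.List using (List; foldr) renaming (map to mapL)
open import Data.List.Membership.Propositional using () renaming (_∈_ to _∈ₗ_)
open import Data.List.Relation.Unary.Unique.Propositional using (Unique)
open import Data.Product using (Σ; ∃; _×_; _,_; proj₁; proj₂)
open import Data.Unit using (⊤; tt)
open import Relation.Nullary using (¬_)
open import Relation.Binary.PropositionalEquality using (_≡_; refl; trans; cong)
open import Relation.Binary.Construct.Closure.Equivalence using (EqClosure)
open import Algebra.Structures using (IsAbelianGroup)
open import Function using (_∘_)

record Sig : Set₁ where
  field
    Ty    : Set
    Rel   : Set
    arity : Rel → ℕ
    ar    : (r : Rel) → Fin (arity r) → Ty

open Sig public

-- A structure: a set of elements, each with a type (so A_t = elements of
-- type t), and relations on tuples which are well-typed.
record Str (S : Sig) : Set₁ where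
  field
    E    : Set
    sort : E → Ty S
    rel  : (r : Rel S) → (Fin (arity S r) → E) → Set
    ws   : ∀ {r x} → rel r x → ∀ i → sort (x i) ≡ ar S r i

record _⟶_ {S : Sig} (A B : Str S) : Set where
  field
    map       : Str.E A → Str.E B
    sort-pres : ∀ e → Str.sort B (map e) ≡ Str.sort A e
    rel-pres  : ∀ r x → Str.rel A r x → Str.rel B r (map ∘ x)

record FinStr (S : Sig) : Set₁ where
  field
    size : ℕ
    sort : Fin size → Ty S
    rel  : (r : Rel S) → (Fin (arity S r) → Fin size) → Set
    ws   : ∀ {r x} → rel r x → ∀ i → sort (x i) ≡ ar S r i

toStr : {S : Sig} → FinStr S → Str S
toStr X = record
  { E = Fin (FinStr.size X) ; sort = FinStr.sort X
  ; rel = FinStr.rel X ; ws = FinStr.ws X }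

-- A structure presented as a quotient: base structure together with a
-- binary relation `ident` of identifications; the quotient is by the
-- equivalence relation generated by `ident`, and its relations are the
-- images of the relations of the base.
record QStr (S : Sig) : Set₁ where
  field
    base  : Str S
    ident : Str.E base → Str.E base → Set

-- Homomorphisms from the quotient structure = homomorphisms from the base
-- that are constant on classes of the generated equivalence relation.
record _⟶q_ {S : Sig} (Q : QStr S) (B : Str S) : Set where
  field
    hom      : QStr.base Q ⟶ B
    respects : ∀ {x y} → EqClosure (QStr.ident Q) x y →
               _⟶_.map hom x ≡ _⟶_.map hom y

natMul : {C : Set} → (C → C → C) → C → ℕ → C → C
natMul _+_ 0# zero    x = 0#
natMul _+_ 0# (suc n) x = x + natMul _+_ 0# n x

intMul : {C : Set} → (C → C → C) → C → (C → C) → ℤ → C → C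
intMul _+_ 0# -_ (+ n)      x = natMul _+_ 0# n x
intMul _+_ 0# -_ (-[1+ n ]) x = - natMul _+_ 0# (suc n) x

record CyclicGroup : Set₁ where
  field
    Carrier        : Set
    _+_            : Carrier → Carrier → Carrier
    0#             : Carrier
    -_             : Carrier → Carrier
    isAbelianGroup : IsAbelianGroup _≡_ _+_ 0# -_
    1#             : Carrier
    generated      : ∀ x → ∃ λ (z : ℤ) → x ≡ intMul _+_ 0# -_ z 1#

data GRel (𝔾 : CyclicGroup) : Set where
  add   : GRel 𝔾
  const : CyclicGroup.Carrier 𝔾 → GRel 𝔾

GSig : CyclicGroup → Sig
GSig 𝔾 = record { Ty = ⊤ ; Rel = GRel 𝔾 ; arity = ar' ; ar = λ _ _ → tt }
  where
  ar' : GRel 𝔾 → ℕ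
  ar' add       = 3
  ar' (const _) = 1

GStr : (𝔾 : CyclicGroup) → Str (GSig 𝔾)
GStr 𝔾 = record { E = Carrier ; sort = λ _ → tt ; rel = rel' ; ws = λ _ _ → refl }
  where
  open CyclicGroup 𝔾
  rel' : (r : GRel 𝔾) → (Fin (arity (GSig 𝔾) r) → Carrier) → Set
  rel' add       x = x Fin.zero + x (Fin.suc Fin.zero) ≡ x (Fin.suc (Fin.suc Fin.zero))
  rel' (const b) x = x Fin.zero ≡ b

module Consistency {S : Sig} (X A : FinStr S) (k : ℕ) where

  n m : ℕ
  n = FinStr.size X
  m = FinStr.size A

  PMap : Set
  PMap = Vec (Maybe (Fin m)) n

  record Small : Set where
    constructor small
    field
      set    : Subset n
      .bound : ∣ set ∣ ≤ k
  open Small public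

  restr : Subset n → PMap → PMap
  restr L f = zipWith (λ s a → if s then a else nothing) L f

  IsPartialHom : Subset n → PMap → Set
  IsPartialHom K f =
      (∀ v → v ∈ K → ∃ λ a → lookup f v ≡ just a)
    × (∀ v → v ∉ K → lookup f v ≡ nothing)
    × (∀ v a → lookup f v ≡ just a → FinStr.sort A a ≡ FinStr.sort X v)
    × (∀ r x → FinStr.rel X r x → (∀ i → x i ∈ K) →
         ∃ λ a → (∀ i → lookup f (x i) ≡ just (a i)) × FinStr.rel A r a)

  -- Stage s of the iteration of step (2) (one simultaneous round per stage).
  Stage : ℕ → Small → PMap → Set
  Stage zero    K f = IsPartialHom (set K) f
  Stage (suc s) K f =
      Stage s K f
    × (∀ K' → set K ⊆ set K' → ∃ λ g → Stage s K' g × restr (set K) g ≡ f)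
    × (∀ L → set L ⊆ set K → Stage s L (restr (set L) f))

  -- the stable family F_K (what survives all rounds)
  InF : Small → PMap → Set
  InF K f = ∀ s → Stage s K f

  record Member (K : Small) : Set where
    constructor member
    field
      pmap : PMap
      .mem : InF K pmap
  open Member public

  restrict : (K L : Small) → set L ⊆ set K → Member K → Member L
  restrict K L L⊆K (member f mem) =
    member (restr (set L) f) (λ s → proj₂ (proj₂ (mem (suc s))) L L⊆K)

  module Kappa {S' : Sig} (B : Str S') where

    -- elements of B^{F_K} (of type ty)
    record CopyElem (K : Small) : Set where
      constructor copyElem
      field
        ty     : Ty S'
        val    : Member K → Str.E B
        sorted : ∀ φ → Str.sort B (val φ) ≡ ty
    open CopyElem public

    UElem : Set
    UElem = Σ Small CopyElem

    -- disjoint union of the copies of B^{F_K}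
    union : Str S'
    union = record
      { E    = UElem
      ; sort = λ u → ty (proj₂ u)
      ; rel  = λ r x → Σ Small λ K → Σ (Fin (arity S' r) → CopyElem K) λ y →
                 (∀ i → x i ≡ (K , y i))
               × (∀ i → ty (y i) ≡ ar S' r i)
               × (∀ φ → Str.rel B r (λ i → val (y i) φ))
      ; ws   = λ { (K , y , eq , tyeq , _) i →
                   trans (cong (λ u → ty (proj₂ u)) (eq i)) (tyeq i) }
      }

    ident : UElem → UElem → Set
    ident (K , c) (L , d) =
      Σ (set L ⊆ set K) λ L⊆K →
        (ty c ≡ ty d) × (∀ φ → val c φ ≡ val d (restrict K L L⊆K φ))

    kappa : QStr S'
    kappa = record { base = union ; ident = ident }

  module Affine (𝔾 : CyclicGroup) where
    open CyclicGroup 𝔾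

    SumIs : (T : Set) → (T → Carrier) → Carrier → Set
    SumIs T x c = Σ (List T) λ l →
      Unique l × (∀ t → t ∈ₗ l) × (foldr _+_ 0# (mapL x l) ≡ c)

    Solvable : Set
    Solvable = Σ ((K : Small) → Member K → Carrier) λ x →
        (∀ K → SumIs (Member K) (x K) 1#)
      × (∀ K L → set L ⊂ set K → (ψ : Member L) →
           SumIs (Σ (Member K) λ φ → restr (set L) (pmap φ) ≡ pmap ψ)
                 (λ p → x K (proj₁ p)) (x L ψ))

κ : {S S' : Sig} → ℕ → (A : FinStr S) → (B : Str S') → FinStr S → QStr S'
κ k A B X = Consistency.Kappa.kappa X A k B

IsReduction : {S S' : Sig} → FinStr S → Str S → Str S' → Str S' →
              (FinStr S → QStr S') → Set₁
IsReduction A A' B B' ψ = (X : FinStr _) →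
    (toStr X ⟶ toStr A → ψ X ⟶q B)
  × (ψ X ⟶q B' → toStr X ⟶ A')

AffineSolves : CyclicGroup → {S : Sig} → FinStr S → Str S → ℕ → Set₁
AffineSolves 𝔾 A A' k = (X : FinStr _) →
    (toStr X ⟶ toStr A → Consistency.Affine.Solvable X A k 𝔾)
  × (¬ (toStr X ⟶ A') → ¬ Consistency.Affine.Solvable X A k 𝔾)

-- Given a homomorphism H from κ_k(X) to G, the values x_{K,f} = H(K ; δ_f) of
-- the indicator functions of the f ∈ F_K satisfy the affine equations: the
-- indicators of F_K sum to the constant 1, and summing the indicators of the
-- fibre of ρ over g gives δ_g ∘ ρ, which κ identifies with (L ; δ_g).
-- Conversely, a cyclic group with generator 1 is a quotient of ℤ and hence a
-- commutative ring, so a solution x defines H(K ; b) = Σ_f x_{K,f} · b(f);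
-- this preserves addition, preserves constants because Σ_f x_{K,f} = 1, and
-- respects the identifications because the fibre equations let one regroup the
-- sum over F_K along the fibres of ρ : F_K → F_L.
module Submission where

open import Defs
open import Level using (0ℓ)
open import Function using (_∘_)
open import Function.Bundles using (_⇔_; mk⇔)
open import Data.Nat using (ℕ; zero; suc; _≤_)
open import Data.Integer using (ℤ; +_; -[1+_])
open import Data.Bool using (true; false; if_then_else_)
open import Data.Unit using (tt)
open import Data.Product using (Σ; ∃; _,_; proj₁; proj₂)
open import Data.Fin using (Fin)
import Data.Fin as Fin
import Data.Fin.Properties as Fin
open import Data.Fin.Subset using (Subset; _⊆_; _⊂_) renaming (_∉_ to _∉ₛ_)
open import Data.Fin.Subset.Properties using (⊆-antisym; _∈?_; _⊂?_; drop-there)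
open import Data.Maybe using (Maybe; just; nothing)
import Data.Maybe.Properties as Maybe
open import Data.Vec using (Vec; []; _∷_; lookup; zipWith)
import Data.Vec.Properties as Vec
open import Data.List using (List; []; _∷_; [_]; _++_; map; foldr; concatMap; allFin; cartesianProductWith)
open import Data.List.Properties using (map-cong; map-∘)
open import Data.List.Relation.Unary.Any using (here; there)
import Data.List.Relation.Unary.Any as Any
import Data.List.Relation.Unary.All as All
import Data.List.Relation.Unary.All.Properties as All
open import Data.List.Relation.Unary.AllPairs using (_∷_)
import Data.List.Relation.Unary.AllPairs as AllPairs
import Data.List.Relation.Unary.AllPairs.Properties as AllPairs
open import Data.List.Membership.Propositional using (_∈_)
open import Data.List.Membership.Propositional.Properties
  using (∈-map⁺; ∈-map⁻; ∈-allFin; ∈-cartesianProductWith⁺; ∈-concatMap⁺)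
open import Data.List.Membership.Propositional.Properties.WithK using (unique∧set⇒bag)
open import Data.List.Relation.Unary.Unique.Propositional using (Unique; [])
open import Data.List.Relation.Unary.Unique.Propositional.Properties
  using (map⁺; allFin⁺; cartesianProductWith⁺; concat⁺)
open import Data.List.Relation.Binary.Disjoint.Propositional using (Disjoint)
open import Data.List.Relation.Binary.BagAndSetEquality using (∼bag⇒↭)
open import Data.List.Relation.Binary.Permutation.Propositional using (_↭_; ↭⇒↭ₛ)
import Data.List.Relation.Binary.Permutation.Propositional.Properties as ↭
import Data.List.Relation.Binary.Permutation.Setoid.Properties as ↭ₛ
open import Algebra.Bundles using (AbelianGroup)
open import Algebra.Structures using (IsAbelianGroup)
import Algebra.Properties.AbelianGroup as AbelianGroupProperties
import Algebra.Properties.CommutativeSemigroup as CommutativeSemigroupProperties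
open import Axiom.ExcludedMiddle using (ExcludedMiddle)
open import Axiom.DoubleNegationElimination using (em⇒dne)
open import Axiom.UniquenessOfIdentityProofs using (module Decidable⇒UIP)
open import Relation.Nullary using (¬_; Dec; yes; no; does; contradiction; contradiction-irr)
import Relation.Nullary.Decidable as Dec
open import Relation.Nullary.Decidable using (dec-true; dec-false; recompute; decidable-stable)
open import Relation.Binary.Definitions using (DecidableEquality)
open import Relation.Binary.Construct.Closure.Equivalence using (gfold)
open import Relation.Binary.Construct.Closure.ReflexiveTransitive using (ε; _◅_)
open import Relation.Binary.Construct.Closure.Symmetric using (fwd)
open import Relation.Binary.PropositionalEquality
  using (_≡_; _≢_; refl; sym; trans; cong; cong₂; setoid; isEquivalence; module ≡-Reasoning)

record Enumeration (T : Set) : Set where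
  field
    list     : List T
    unique   : Unique list
    complete : ∀ t → t ∈ list

open Enumeration

Fin-enumeration : ∀ m → Enumeration (Fin m)
Fin-enumeration m = record { list = allFin m ; unique = allFin⁺ m ; complete = ∈-allFin }

Maybe-enumeration : ∀ {T} → Enumeration T → Enumeration (Maybe T)
Maybe-enumeration e = record
  { list     = nothing ∷ map just (list e)
  ; unique   = All.tabulate nothing∉ ∷ map⁺ Maybe.just-injective (unique e)
  ; complete = λ { nothing → here refl ; (just t) → there (∈-map⁺ just (complete e t)) }
  }
  where
  nothing∉ : ∀ {a} → a ∈ map just (list e) → nothing ≢ a
  nothing∉ a∈ with ∈-map⁻ just a∈
  ... | _ , _ , refl = λ ()

Vec-enumeration : ∀ {T} → Enumeration T → ∀ n → Enumeration (Vec T n)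
Vec-enumeration e zero    =
  record { list = [ [] ] ; unique = All.[] ∷ [] ; complete = λ { [] → here refl } }
Vec-enumeration e (suc n) = record
  { list     = cartesianProductWith _∷_ (list e) (list rest)
  ; unique   = cartesianProductWith⁺ _∷_ Vec.∷-injective (unique e) (unique rest)
  ; complete = λ { (t ∷ ts) → ∈-cartesianProductWith⁺ _∷_ (complete e t) (complete rest ts) }
  }
  where rest = Vec-enumeration e n

module _ {S T : Set} (key : S → T) (key-injective : ∀ {s s'} → key s ≡ key s' → s ≡ s')
         (image? : ∀ t → Dec (∃ λ s → key s ≡ t)) where

  preimages : List T → List S
  preimages []       = []
  preimages (t ∷ ts) with image? t
  ... | yes (s , _) = s ∷ preimages ts
  ... | no _        = preimages ts

  ∈-preimages⁻ : ∀ {s} ts → s ∈ preimages ts → key s ∈ ts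
  ∈-preimages⁻ (t ∷ ts) s∈ with image? t | s∈
  ... | yes (s , eq) | here refl = here eq
  ... | yes _        | there s∈' = there (∈-preimages⁻ ts s∈')
  ... | no _         | s∈'       = there (∈-preimages⁻ ts s∈')

  ∈-preimages⁺ : ∀ {s} ts → key s ∈ ts → s ∈ preimages ts
  ∈-preimages⁺ {s} (t ∷ ts) s∈ with image? t | s∈
  ... | yes (s' , eq) | here eq' = here (key-injective (trans eq' (sym eq)))
  ... | yes _         | there s∈' = there (∈-preimages⁺ ts s∈')
  ... | no ∄          | here eq   = contradiction (s , eq) ∄
  ... | no _          | there s∈' = ∈-preimages⁺ ts s∈'

  preimages⁺ : ∀ {ts} → Unique ts → Unique (preimages ts)
  preimages⁺ {[]}     []           = []
  preimages⁺ {t ∷ ts} (t∉ts ∷ uts) with image? t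
  ... | yes (s , refl) =
    All.tabulate (λ s'∈ s≡s' → All.lookup t∉ts (∈-preimages⁻ ts s'∈) (cong key s≡s'))
      ∷ preimages⁺ uts
  ... | no _ = preimages⁺ uts

  preimage-enumeration : Enumeration T → Enumeration S
  preimage-enumeration e = record
    { list     = preimages (list e)
    ; unique   = preimages⁺ (unique e)
    ; complete = λ s → ∈-preimages⁺ (list e) (complete e (key s))
    }

module CyclicRing (𝔾 : CyclicGroup) where
  open CyclicGroup 𝔾
  open IsAbelianGroup isAbelianGroup
    using (assoc; identityˡ; identityʳ; inverseʳ; isCommutativeMonoid)

  abelianGroup : AbelianGroup 0ℓ 0ℓ
  abelianGroup = record { isAbelianGroup = isAbelianGroup }

  open AbelianGroup abelianGroup using (commutativeSemigroup)
  open AbelianGroupProperties abelianGroup using (⁻¹-∙-comm; inverseʳ-unique; identityˡ-unique)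
  open CommutativeSemigroupProperties commutativeSemigroup using (interchange)

  infixr 30 _·_
  infixl 25 _*_

  _·_ : ℤ → Carrier → Carrier
  z · a = intMul _+_ 0# -_ z a

  IsAdditive : (Carrier → Carrier) → Set
  IsAdditive f = ∀ a b → f (a + b) ≡ f a + f b

  module _ {f : Carrier → Carrier} (additive : IsAdditive f) where

    additive-0# : f 0# ≡ 0#
    additive-0# = identityˡ-unique (f 0#) (f 0#)
      (trans (sym (additive 0# 0#)) (cong f (identityˡ 0#)))

    additive-⁻ : ∀ a → f (- a) ≡ - f a
    additive-⁻ a = inverseʳ-unique (f a) (f (- a))
      (trans (sym (additive a (- a))) (trans (cong f (inverseʳ a)) additive-0#))

    additive-natMul : ∀ n a → f (natMul _+_ 0# n a) ≡ natMul _+_ 0# n (f a)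
    additive-natMul zero    a = additive-0#
    additive-natMul (suc n) a =
      trans (additive a _) (cong (_+_ (f a)) (additive-natMul n a))

    additive-· : ∀ z a → f (z · a) ≡ z · f a
    additive-· (+ n)      a = additive-natMul n a
    additive-· -[1+ n ]   a =
      trans (additive-⁻ (natMul _+_ 0# (suc n) a)) (cong -_ (additive-natMul (suc n) a))

  natMul-additive : ∀ n → IsAdditive (natMul _+_ 0# n)
  natMul-additive zero    a b = sym (identityˡ 0#)
  natMul-additive (suc n) a b =
    trans (cong (_+_ (a + b)) (natMul-additive n a b)) (interchange a b _ _)

  ·-additive : ∀ z → IsAdditive (z ·_)
  ·-additive (+ n)    = natMul-additive n
  ·-additive -[1+ n ] a b =
    trans (cong -_ (natMul-additive (suc n) a b)) (sym (⁻¹-∙-comm _ _))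

  ·-comm : ∀ z w a → z · w · a ≡ w · z · a
  ·-comm z = additive-· (·-additive z)

  index : Carrier → ℤ
  index b = proj₁ (generated b)

  index-· : ∀ b → index b · 1# ≡ b
  index-· b = sym (proj₂ (generated b))

  _*_ : Carrier → Carrier → Carrier
  a * b = index b · a

  *-distribʳ : ∀ a a' b → (a + a') * b ≡ a * b + a' * b
  *-distribʳ a a' b = ·-additive (index b) a a'

  *-zeroˡ : ∀ b → 0# * b ≡ 0#
  *-zeroˡ b = additive-0# (·-additive (index b))

  *-identityˡ : ∀ b → 1# * b ≡ b
  *-identityˡ = index-·

  *-comm : ∀ a b → a * b ≡ b * a
  *-comm a b = begin
    index b · a             ≡⟨ cong (index b ·_) (sym (index-· a)) ⟩
    index b · index a · 1#  ≡⟨ ·-comm (index b) (index a) 1# ⟩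
    index a · index b · 1#  ≡⟨ cong (index a ·_) (index-· b) ⟩
    index a · b             ∎
    where open ≡-Reasoning

  *-distribˡ : ∀ a b b' → a * (b + b') ≡ a * b + a * b'
  *-distribˡ a b b' = begin
    a * (b + b')        ≡⟨ *-comm a (b + b') ⟩
    (b + b') * a        ≡⟨ *-distribʳ b b' a ⟩
    b * a + b' * a      ≡⟨ cong₂ _+_ (*-comm b a) (*-comm b' a) ⟩
    a * b + a * b'      ∎
    where open ≡-Reasoning

  ∑ : {T : Set} → List T → (T → Carrier) → Carrier
  ∑ l f = foldr _+_ 0# (map f l)

  module _ {T : Set} where

    ∑-cong : ∀ (l : List T) {f g} → (∀ t → f t ≡ g t) → ∑ l f ≡ ∑ l g
    ∑-cong l f≗g = cong (foldr _+_ 0#) (map-cong f≗g l)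

    ∑-+ : ∀ (l : List T) f g → ∑ l f + ∑ l g ≡ ∑ l (λ t → f t + g t)
    ∑-+ []      f g = identityˡ 0#
    ∑-+ (t ∷ l) f g = trans (interchange (f t) _ (g t) _) (cong (_+_ (f t + g t)) (∑-+ l f g))

    ∑-distribʳ : ∀ (l : List T) f b → ∑ l f * b ≡ ∑ l (λ t → f t * b)
    ∑-distribʳ []      f b = *-zeroˡ b
    ∑-distribʳ (t ∷ l) f b = trans (*-distribʳ (f t) _ b) (cong (_+_ (f t * b)) (∑-distribʳ l f b))

    ∑-++ : ∀ (l l' : List T) f → ∑ (l ++ l') f ≡ ∑ l f + ∑ l' f
    ∑-++ []      l' f = sym (identityˡ _)
    ∑-++ (t ∷ l) l' f = trans (cong (_+_ (f t)) (∑-++ l l' f)) (sym (assoc (f t) _ _))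

    ∑-↭ : ∀ {l l' : List T} f → l ↭ l' → ∑ l f ≡ ∑ l' f
    ∑-↭ f l↭l' =
      ↭ₛ.foldr-commMonoid (setoid Carrier) isCommutativeMonoid (↭⇒↭ₛ (↭.map⁺ f l↭l'))

    ∑-enumeration : ∀ (e e' : Enumeration T) f → ∑ (list e) f ≡ ∑ (list e') f
    ∑-enumeration e e' f = ∑-↭ f (∼bag⇒↭ (unique∧set⇒bag (unique e) (unique e')
      (mk⇔ (λ _ → complete e' _) (λ _ → complete e _))))

  ∑-map : ∀ {S T : Set} (l : List S) (g : S → T) f → ∑ (map g l) f ≡ ∑ l (f ∘ g)
  ∑-map l g f = cong (foldr _+_ 0#) (sym (map-∘ l))

  ∑-concatMap : ∀ {S T : Set} (l : List T) (h : T → List S) f →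
                ∑ (concatMap h l) f ≡ ∑ l (λ t → ∑ (h t) f)
  ∑-concatMap []      h f = refl
  ∑-concatMap (t ∷ l) h f = trans (∑-++ (h t) _ f) (cong (_+_ (∑ (h t) f)) (∑-concatMap l h f))

  ∑-partition : ∀ {S T : Set} (ρ : S → T) (eS : Enumeration S) (eT : Enumeration T)
    (fibre : T → List S) → (∀ t → Unique (fibre t)) →
    (∀ {s t} → s ∈ fibre t → ρ s ≡ t) → (∀ s → s ∈ fibre (ρ s)) →
    ∀ f → ∑ (list eT) (λ t → ∑ (fibre t) f) ≡ ∑ (list eS) f
  ∑-partition ρ eS eT fibre fibre-unique ∈-fibre⁻ ∈-fibre⁺ f =
    trans (sym (∑-concatMap (list eT) fibre f)) (∑-enumeration fibres eS f)
    where
    fibres : Enumeration _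
    fibres = record
      { list     = concatMap fibre (list eT)
      ; unique   = concat⁺ (All.map⁺ (All.tabulate (λ {t} _ → fibre-unique t)))
                           (AllPairs.map⁺ (AllPairs.map disjoint (unique eT)))
      ; complete = λ s →
          ∈-concatMap⁺ fibre (Any.map (λ { refl → ∈-fibre⁺ s }) (complete eT (ρ s)))
      }
      where
      disjoint : ∀ {t t'} → t ≢ t' → Disjoint (fibre t) (fibre t')
      disjoint t≢t' (s∈t , s∈t') = t≢t' (trans (sym (∈-fibre⁻ s∈t)) (∈-fibre⁻ s∈t'))

  module Indicator {T : Set} (_≟_ : DecidableEquality T) where

    δ : T → T → Carrier
    δ a b = if does (a ≟ b) then 1# else 0#

    δ-≡ : ∀ {a b} → a ≡ b → δ a b ≡ 1#
    δ-≡ {a} {b} a≡b = cong (λ x → if x then 1# else 0#) (dec-true (a ≟ b) a≡b)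

    δ-≢ : ∀ {a b} → a ≢ b → δ a b ≡ 0#
    δ-≢ {a} {b} a≢b = cong (λ x → if x then 1# else 0#) (dec-false (a ≟ b) a≢b)

    module _ {S : Set} (key : S → T) where

      ∑-δ-miss : ∀ (l : List S) {t} → (∀ {s} → s ∈ l → key s ≢ t) →
                 ∑ l (λ s → δ (key s) t) ≡ 0#
      ∑-δ-miss []      miss = refl
      ∑-δ-miss (s ∷ l) miss =
        trans (cong₂ _+_ (δ-≢ (miss (here refl))) (∑-δ-miss l (miss ∘ there))) (identityˡ 0#)

      ∑-δ-hit : (∀ {s s'} → key s ≡ key s' → s ≡ s') →
                ∀ {l} → Unique l → ∀ {s} → s ∈ l → ∑ l (λ s' → δ (key s') (key s)) ≡ 1#
      ∑-δ-hit key-injective (s∉l ∷ _) (here refl) =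
        trans (cong₂ _+_ (δ-≡ refl) (∑-δ-miss _ λ s'∈l eq → All.lookup s∉l s'∈l (sym (key-injective eq))))
              (identityʳ 1#)
      ∑-δ-hit key-injective (s'∉l ∷ ul) (there s∈l) =
        trans (cong₂ _+_ (δ-≢ λ eq → All.lookup s'∉l s∈l (key-injective eq)) (∑-δ-hit key-injective ul s∈l))
              (identityˡ 1#)

⊆∧⊄⇒≡ : ∀ {n} {p q : Subset n} → p ⊆ q → ¬ p ⊂ q → p ≡ q
⊆∧⊄⇒≡ {p = p} p⊆q p⊄q = ⊆-antisym p⊆q λ {v} v∈q →
  decidable-stable (v ∈? p) (λ v∉p → p⊄q (p⊆q , v , v∈q , v∉p))

-- Consistency.restr, for vectors of any length.
select : ∀ {j} {B : Set} → Subset j → Vec (Maybe B) j → Vec (Maybe B) j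
select K f = zipWith (λ s a → if s then a else nothing) K f

select-id : ∀ {j} {B : Set} (K : Subset j) (f : Vec (Maybe B) j) →
            (∀ v → v ∉ₛ K → lookup f v ≡ nothing) → select K f ≡ f
select-id []          []      _       = refl
select-id (true ∷ K)  (a ∷ f) outside =
  cong (a ∷_) (select-id K f λ v v∉K → outside (Fin.suc v) (v∉K ∘ drop-there))
select-id (false ∷ K) (a ∷ f) outside =
  cong₂ _∷_ (sym (outside Fin.zero λ ())) (select-id K f λ v v∉K → outside (Fin.suc v) (v∉K ∘ drop-there))

module Relaxation (𝔾 : CyclicGroup) {S : Sig} (X A : FinStr S) (k : ℕ) where
  open Consistency X A k
  open Kappa (GStr 𝔾)
  open Affine 𝔾
  open CyclicGroup 𝔾
  open CyclicRing 𝔾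

  _≟ₚ_ : DecidableEquality PMap
  _≟ₚ_ = Vec.≡-dec (Maybe.≡-dec Fin._≟_)

  Member-≡ : ∀ {K} {φ ψ : Member K} → pmap φ ≡ pmap ψ → φ ≡ ψ
  Member-≡ {φ = member _ _} {member _ _} refl = refl

  _≟ₘ_ : ∀ {K} → DecidableEquality (Member K)
  φ ≟ₘ ψ = Dec.map′ Member-≡ (cong pmap) (pmap φ ≟ₚ pmap ψ)

  -- Membership in F_K quantifies over all stages of step (2), so only excluded
  -- middle decides it.
  members : ExcludedMiddle 0ℓ → ∀ K → Enumeration (Member K)
  members em K = preimage-enumeration pmap Member-≡ member?
    (Vec-enumeration (Maybe-enumeration (Fin-enumeration m)) n)
    where
    member? : ∀ f → Dec (∃ λ φ → pmap φ ≡ f)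
    member? f with em {InF K f}
    ... | yes f∈F = yes (member f f∈F , refl)
    ... | no  f∉F = no λ { (member _ f∈F , refl) → contradiction-irr f∈F f∉F }

  -- f∈F is irrelevant, so the equation it yields is recomputed by deciding it.
  restrict-id : ∀ K (K⊆K : set K ⊆ set K) φ → restrict K K K⊆K φ ≡ φ
  restrict-id K _ (member f f∈F) =
    Member-≡ (recompute (_ ≟ₚ f) (select-id (set K) f (proj₁ (proj₂ (f∈F 0)))))

  Fibre : (K L : Small) → Member L → Set
  Fibre K L ψ = Σ (Member K) λ φ → restr (set L) (pmap φ) ≡ pmap ψ

  Fibre-proj₁-injective : ∀ {K L ψ} {p q : Fibre K L ψ} → proj₁ p ≡ proj₁ q → p ≡ q
  Fibre-proj₁-injective {p = φ , e} {.φ , e'} refl =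
    cong (φ ,_) (Decidable⇒UIP.≡-irrelevant _≟ₚ_ e e')

  fibre-enumeration : ExcludedMiddle 0ℓ → ∀ K L ψ → Enumeration (Fibre K L ψ)
  fibre-enumeration em K L ψ =
    preimage-enumeration proj₁ (Fibre-proj₁-injective {K} {L} {ψ}) in-fibre? (members em K)
    where
    in-fibre? : ∀ φ → Dec (∃ λ (p : Fibre K L ψ) → proj₁ p ≡ φ)
    in-fibre? φ = Dec.map′ (λ e → (φ , e) , refl) (λ { ((_ , e) , refl) → e })
                           (restr (set L) (pmap φ) ≟ₚ pmap ψ)

  sumIs : ∀ {T x c} (e : Enumeration T) → ∑ (list e) x ≡ c → SumIs T x c
  sumIs e ∑≡c = list e , unique e , complete e , ∑≡c

  enumeration : ∀ {T x c} → SumIs T x c → Enumeration T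
  enumeration (l , u , c , _) = record { list = l ; unique = u ; complete = c }

  sum : ∀ {T x c} (s : SumIs T x c) → ∑ (list (enumeration s)) x ≡ c
  sum (_ , _ , _ , ∑≡c) = ∑≡c

  module FromHomomorphism (em : ExcludedMiddle 0ℓ) (H : kappa ⟶q GStr 𝔾) where
    open _⟶q_ H using (hom; respects)
    open _⟶_ hom using (rel-pres)

    copy : ∀ {K} → (Member K → Carrier) → CopyElem K
    copy v = copyElem tt v (λ _ → refl)

    h : (K : Small) → (Member K → Carrier) → Carrier
    h K v = _⟶_.map hom (K , copy v)

    h-+ : ∀ K {a b c} → (∀ φ → a φ + b φ ≡ c φ) → h K a + h K b ≡ h K c
    h-+ K {a} {b} {c} a+b≗c =
      rel-pres add (λ i → K , triple i) (K , triple , (λ _ → refl) , (λ _ → refl) , a+b≗c)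
      where
      triple : Fin 3 → CopyElem K
      triple Fin.zero                     = copy a
      triple (Fin.suc Fin.zero)           = copy b
      triple (Fin.suc (Fin.suc Fin.zero)) = copy c

    h-const : ∀ K {a} b → (∀ φ → a φ ≡ b) → h K a ≡ b
    h-const K {a} b a≗b =
      rel-pres (const b) (λ _ → K , copy a) (K , (λ _ → copy a) , (λ _ → refl) , (λ _ → refl) , a≗b)

    h-∑ : ∀ K {T : Set} (l : List T) (g : T → Member K → Carrier) {c} →
          (∀ φ → ∑ l (λ t → g t φ) ≡ c φ) → ∑ l (λ t → h K (g t)) ≡ h K c
    h-∑ K []      g ∑≗c = sym (h-const K 0# (sym ∘ ∑≗c))
    h-∑ K (t ∷ l) g ∑≗c = trans (cong (_+_ (h K (g t))) (h-∑ K l g λ _ → refl)) (h-+ K ∑≗c)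

    h-restrict : ∀ K L (L⊆K : set L ⊆ set K) d → h K (d ∘ restrict K L L⊆K) ≡ h L d
    h-restrict K L L⊆K d = respects (fwd (L⊆K , refl , λ _ → refl) ◅ ε)

    module Indicatorₘ (K : Small) = Indicator (_≟ₘ_ {K})
    open Indicatorₘ

    x : (K : Small) → Member K → Carrier
    x K f = h K (δ K f)

    ∑-x : ∀ K → ∑ (list (members em K)) (x K) ≡ 1#
    ∑-x K = trans (h-∑ K (list M) (δ K) λ φ → ∑-δ-hit K (λ f → f) (λ e → e) (unique M) (complete M φ))
                  (h-const K 1# λ _ → refl)
      where M = members em K

    ∑-x-fibre : ∀ K L (L⊆K : set L ⊆ set K) ψ →
                ∑ (list (fibre-enumeration em K L ψ)) (x K ∘ proj₁) ≡ x L ψ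
    ∑-x-fibre K L L⊆K ψ = trans (h-∑ K (list F) (δ K ∘ proj₁) count) (h-restrict K L L⊆K (δ L ψ))
      where
      F = fibre-enumeration em K L ψ
      count : ∀ φ → ∑ (list F) (λ p → δ K (proj₁ p) φ) ≡ δ L ψ (restrict K L L⊆K φ)
      count φ with restrict K L L⊆K φ ≟ₘ ψ
      ... | yes ρφ≡ψ =
        trans (∑-δ-hit K proj₁ (Fibre-proj₁-injective {K} {L} {ψ}) (unique F) (complete F (φ , cong pmap ρφ≡ψ)))
              (sym (δ-≡ L (sym ρφ≡ψ)))
      ... | no  ρφ≢ψ =
        trans (∑-δ-miss K proj₁ (list F) {φ} λ { {_ , e} _ refl → ρφ≢ψ (Member-≡ e) })
              (sym (δ-≢ L (ρφ≢ψ ∘ sym)))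

    solution : Solvable
    solution = x , (λ K → sumIs (members em K) (∑-x K))
                 , (λ K L L⊂K ψ → sumIs (fibre-enumeration em K L ψ) (∑-x-fibre K L (proj₁ L⊂K) ψ))

  module FromSolution (sol : Solvable) where

    x : (K : Small) → Member K → Carrier
    x = proj₁ sol

    M : (K : Small) → Enumeration (Member K)
    M K = enumeration (proj₁ (proj₂ sol) K)

    ∑-x : ∀ K → ∑ (list (M K)) (x K) ≡ 1#
    ∑-x K = sum (proj₁ (proj₂ sol) K)

    F : ∀ K L → set L ⊂ set K → (ψ : Member L) → Enumeration (Fibre K L ψ)
    F K L L⊂K ψ = enumeration (proj₂ (proj₂ sol) K L L⊂K ψ)

    ∑-x-fibre : ∀ K L (L⊂K : set L ⊂ set K) ψ → ∑ (list (F K L L⊂K ψ)) (x K ∘ proj₁) ≡ x L ψ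
    ∑-x-fibre K L L⊂K ψ = sum (proj₂ (proj₂ sol) K L L⊂K ψ)

    ⟦_⟧ : (K : Small) → (Member K → Carrier) → Carrier
    ⟦ K ⟧ v = ∑ (list (M K)) (λ φ → x K φ * v φ)

    ⟦⟧-+ : ∀ K {a b c} → (∀ φ → a φ + b φ ≡ c φ) → ⟦ K ⟧ a + ⟦ K ⟧ b ≡ ⟦ K ⟧ c
    ⟦⟧-+ K a+b≗c = trans (∑-+ (list (M K)) _ _) (∑-cong (list (M K)) λ φ →
      trans (sym (*-distribˡ (x K φ) _ _)) (cong (x K φ *_) (a+b≗c φ)))

    ⟦⟧-const : ∀ K {a} b → (∀ φ → a φ ≡ b) → ⟦ K ⟧ a ≡ b
    ⟦⟧-const K {a} b a≗b = begin
      ∑ (list (M K)) (λ φ → x K φ * a φ)  ≡⟨ ∑-cong (list (M K)) (λ φ → cong (x K φ *_) (a≗b φ)) ⟩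
      ∑ (list (M K)) (λ φ → x K φ * b)    ≡⟨ sym (∑-distribʳ (list (M K)) (x K) b) ⟩
      ∑ (list (M K)) (x K) * b            ≡⟨ cong (_* b) (∑-x K) ⟩
      1# * b                              ≡⟨ *-identityˡ b ⟩
      b                                   ∎
      where open ≡-Reasoning

    ⟦⟧-restrict-≡ : ∀ K L (L⊆K : set L ⊆ set K) → set L ≡ set K → ∀ d →
                    ⟦ K ⟧ (d ∘ restrict K L L⊆K) ≡ ⟦ L ⟧ d
    ⟦⟧-restrict-≡ K@(small s _) (small .s _) L⊆K refl d =
      ∑-cong (list (M K)) λ φ → cong (λ φ' → x K φ * d φ') (restrict-id K L⊆K φ)

    ⟦⟧-restrict-⊂ : ∀ K L (L⊆K : set L ⊆ set K) (L⊂K : set L ⊂ set K) d →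
                    ⟦ K ⟧ (d ∘ restrict K L L⊆K) ≡ ⟦ L ⟧ d
    ⟦⟧-restrict-⊂ K L L⊆K L⊂K d =
      trans (sym (∑-partition ρ (M K) (M L) fibre fibre-unique ∈-fibre⁻ ∈-fibre⁺ g))
            (∑-cong (list (M L)) fibre-weight)
      where
      ρ : Member K → Member L
      ρ = restrict K L L⊆K

      g : Member K → Carrier
      g φ = x K φ * d (ρ φ)

      fibre : Member L → List (Member K)
      fibre ψ = map proj₁ (list (F K L L⊂K ψ))

      fibre-unique : ∀ ψ → Unique (fibre ψ)
      fibre-unique ψ = map⁺ (Fibre-proj₁-injective {K} {L} {ψ}) (unique (F K L L⊂K ψ))

      ∈-fibre⁻ : ∀ {φ ψ} → φ ∈ fibre ψ → ρ φ ≡ ψ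
      ∈-fibre⁻ φ∈ with ∈-map⁻ proj₁ φ∈
      ... | (_ , e) , _ , refl = Member-≡ e

      ∈-fibre⁺ : ∀ φ → φ ∈ fibre (ρ φ)
      ∈-fibre⁺ φ = ∈-map⁺ proj₁ (complete (F K L L⊂K (ρ φ)) (φ , refl))

      fibre-weight : ∀ ψ → ∑ (fibre ψ) g ≡ x L ψ * d ψ
      fibre-weight ψ = begin
        ∑ (map proj₁ Fψ) g                ≡⟨ ∑-map Fψ proj₁ g ⟩
        ∑ Fψ (g ∘ proj₁)                  ≡⟨ ∑-cong Fψ (λ { (φ , e) → cong (λ ψ' → x K φ * d ψ') (Member-≡ e) }) ⟩
        ∑ Fψ (λ p → x K (proj₁ p) * d ψ)  ≡⟨ sym (∑-distribʳ Fψ (x K ∘ proj₁) (d ψ)) ⟩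
        ∑ Fψ (x K ∘ proj₁) * d ψ          ≡⟨ cong (_* d ψ) (∑-x-fibre K L L⊂K ψ) ⟩
        x L ψ * d ψ                       ∎
        where
        open ≡-Reasoning
        Fψ = list (F K L L⊂K ψ)

    ⟦⟧-restrict : ∀ K L (L⊆K : set L ⊆ set K) d → ⟦ K ⟧ (d ∘ restrict K L L⊆K) ≡ ⟦ L ⟧ d
    ⟦⟧-restrict K L L⊆K d with set L ⊂? set K
    ... | yes L⊂K = ⟦⟧-restrict-⊂ K L L⊆K L⊂K d
    ... | no  L⊄K = ⟦⟧-restrict-≡ K L L⊆K (⊆∧⊄⇒≡ L⊆K L⊄K) d

    ⟦_⟧ᵤ : UElem → Carrier
    ⟦ K , c ⟧ᵤ = ⟦ K ⟧ (val c)

    ⟦⟧ᵤ-rel-pres : ∀ r us → Str.rel union r us → Str.rel (GStr 𝔾) r (⟦_⟧ᵤ ∘ us)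
    ⟦⟧ᵤ-rel-pres add us (K , cs , us≡ , _ , +≗) =
      trans (cong₂ _+_ (cong ⟦_⟧ᵤ (us≡ Fin.zero)) (cong ⟦_⟧ᵤ (us≡ (Fin.suc Fin.zero))))
            (trans (⟦⟧-+ K +≗) (cong ⟦_⟧ᵤ (sym (us≡ (Fin.suc (Fin.suc Fin.zero))))))
    ⟦⟧ᵤ-rel-pres (const b) us (K , cs , us≡ , _ , ≗b) =
      trans (cong ⟦_⟧ᵤ (us≡ Fin.zero)) (⟦⟧-const K b ≗b)

    ⟦⟧ᵤ-ident : ∀ {u v} → ident u v → ⟦ u ⟧ᵤ ≡ ⟦ v ⟧ᵤ
    ⟦⟧ᵤ-ident {K , c} {L , d} (L⊆K , _ , c≗d) =
      trans (∑-cong (list (M K)) λ φ → cong (x K φ *_) (c≗d φ)) (⟦⟧-restrict K L L⊆K (val d))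

    homomorphism : kappa ⟶q GStr 𝔾
    homomorphism = record
      { hom      = record { map = ⟦_⟧ᵤ ; sort-pres = λ _ → refl ; rel-pres = ⟦⟧ᵤ-rel-pres }
      ; respects = gfold isEquivalence ⟦_⟧ᵤ (λ {u} {v} → ⟦⟧ᵤ-ident {u} {v})
      }

lemma4p8 : ExcludedMiddle 0ℓ → (𝔾 : CyclicGroup) → {S : Sig} →
    (A : FinStr S) → (A' : Str S) → toStr A ⟶ A' →
    (k : ℕ) → 1 ≤ k →
    AffineSolves 𝔾 A A' k ⇔ IsReduction A A' (GStr 𝔾) (GStr 𝔾) (κ k A (GStr 𝔾))
lemma4p8 em 𝔾 A A' _ k _ = mk⇔
  (λ solves X → (FromSolution.homomorphism X ∘ proj₁ (solves X))
              , (λ H → em⇒dne em λ X↛A' → proj₂ (solves X) X↛A' (FromHomomorphism.solution X em H)))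
  (λ reduces X → (FromHomomorphism.solution X em ∘ proj₁ (reduces X))
               , (λ X↛A' sol → X↛A' (proj₂ (reduces X) (FromSolution.homomorphism X sol))))
  where open module Relaxationₓ X = Relaxation 𝔾 X A k
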